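{- Let $x,y\in V(C)$ with $\mathrm{dist}_C(x,y)\ge 4$. Then there is no edge of $G$ between $Z_x$ and $Z_y$.
   Context: Graphs are finite and simple. A hole is an induced cycle of length at least $4$; a graph is chordal if it has no hole. Let $s_k=4k(\log k+\log\log k+4)$ for $k\ge2$, $s_1=2$, and $\mu_k=76s_{k+1}+3217k+1985$. Standing assumptions: $G$ is a graph, $k$ a positive integer, $C$ a shortest hole of $G$ of length strictly greater than $\mu_k$, and $G-V(C)$ is chordal. $D$ is the set of vertices of $G$ adjacent to every vertex of $C$; for $v\in V(C)$, $Z_v=\{v\}\cup(N(v)\setminus V(C)\setminus D)$. $\mathrm{dist}_C$ denotes distance in the cycle $C$. -}

module Defs where

open import Data.Nat as ℕ using (ℕ; zero; suc; _≤_; _+_; _*_; _∸_; _⊓_; ∣_-_∣)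
open import Data.Integer as ℤ using (ℤ; +_)
open import Data.Rational as ℚ using (ℚ; 0ℚ; 1ℚ)
open import Data.Fin using (Fin; toℕ)
open import Data.Bool using (Bool; true)
open import Data.Product using (Σ; ∃; ∃-syntax; _×_; _,_)
open import Data.Sum using (_⊎_)
open import Relation.Nullary using (¬_)
open import Relation.Binary.PropositionalEquality using (_≡_)
open import Function.Definitions using (Injective)
open import Function.Bundles using (_⇔_)

record Graph : Set where
  field
    n      : ℕ
    adj    : Fin n → Fin n → Bool
    sym    : ∀ u v → adj u v ≡ adj v u
    irrefl : ∀ v → ¬ (adj v v ≡ true)

open Graph public

Vertex : Graph → Set
Vertex G = Fin (n G)

Adj : (G : Graph) → Vertex G → Vertex G → Set
Adj G u v = adj G u v ≡ true

CycSucc : (len : ℕ) → Fin len → Fin len → Set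
CycSucc len i j = (toℕ j ≡ suc (toℕ i)) ⊎ ((suc (toℕ i) ≡ len) × (toℕ j ≡ 0))

CycAdj : (len : ℕ) → Fin len → Fin len → Set
CycAdj len i j = CycSucc len i j ⊎ CycSucc len j i

record Hole (G : Graph) : Set where
  field
    len     : ℕ
    len≥4   : 4 ≤ len
    vtx     : Fin len → Vertex G
    inj     : Injective _≡_ _≡_ vtx
    induced : ∀ i j → Adj G (vtx i) (vtx j) ⇔ CycAdj len i j

open Hole public

InHole : {G : Graph} → Hole G → Vertex G → Set
InHole C v = ∃[ i ] vtx C i ≡ v

ShortestHole : {G : Graph} → Hole G → Set
ShortestHole {G} C = (H : Hole G) → len C ≤ len H

-- G - V(C) is chordal: G - V(C) is an induced subgraph, so its holes are
-- exactly the holes of G avoiding V(C); there is none.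
ChordalMinus : {G : Graph} → Hole G → Set
ChordalMinus {G} C = ¬ (Σ (Hole G) λ H → ∀ i → ¬ InHole C (vtx H i))

InD : {G : Graph} → Hole G → Vertex G → Set
InD {G} C v = ∀ i → Adj G (vtx C i) v

InZ : {G : Graph} → Hole G → Vertex G → Vertex G → Set
InZ {G} C v a = (a ≡ v) ⊎ (Adj G v a × ¬ InHole C a × ¬ InD C a)

distC : {G : Graph} (C : Hole G) → Fin (len C) → Fin (len C) → ℕ
distC C i j = d ⊓ (len C ∸ d)
  where d = ∣ toℕ i - toℕ j ∣

-- The threshold μ_k = 76 s_{k+1} + 3217k + 1985, with
-- s_m = 4m(ln m + ln ln m + 4) for m ≥ 2 (natural logarithm).
-- Since k ≥ 1 only s_{k+1} with k+1 ≥ 2 is needed.  There are no reals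
-- in the library, so the (strict) comparison  μ_k < L  for a natural L
-- is encoded exactly via rational lower bounds of exp (Taylor partial
-- sums, which increase to exp x for x ≥ 0).  Writing m = k+1 and
-- R = (L - 3217k - 1985)/(304 m):
--   μ_k < L  ⇔  ln m + ln ln m + 4 < R  ⇔  m·ln m < exp(R - 4)
--           ⇔  ∃ rational u > 0 with m < exp u and m·u < exp(R-4).

expTerm : ℚ → ℕ → ℚ
expTerm x zero    = 1ℚ
expTerm x (suc i) = expTerm x i ℚ.* x ℚ.* ((+ 1) ℚ./ suc i)

expPartial : ℚ → ℕ → ℚ
expPartial x zero    = 1ℚ
expPartial x (suc N) = expPartial x N ℚ.+ expTerm x (suc N)

LtExp : ℚ → ℚ → Set
LtExp y x = (0ℚ ℚ.≤ x) × (∃[ N ] (y ℚ.< expPartial x N))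

muR : ℕ → ℕ → ℚ
muR k L = ((+ L) ℤ.- (+ (3217 * k + 1985))) ℚ./ (304 * suc k)

MuLt : ℕ → ℕ → Set
MuLt k L = ∃[ u ] ((0ℚ ℚ.< u) × LtExp m u × LtExp (m ℚ.* u) (muR k L ℚ.- (+ 4 ℚ./ 1)))
  where m = + suc k ℚ./ 1

{-# OPTIONS --safe #-}
module Submission where

-- If a vertex w outside C sees two vertices of C at
-- C-distance at least 3 but misses some vertex of C, then w together with the arc of C between the
-- two neighbours of w enclosing a missed vertex is a hole shorter than C.  Hence the neighbours on C
-- of a vertex of Z_v − v lie within C-distance 2 of each other.  For adjacent a ∈ Z_x − x and
-- b ∈ Z_y − y, let s be the last neighbour of a on the arc from x to y and e the first neighbour of
-- b on that arc from s on.  If s < e, then a, b and the arc from s to e form a hole shorter than C.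
-- If s = e, then y = x + 4 and s = x + 2; the same argument on the complementary arc, from y to x,
-- gives a neighbour x + 6 of a, too far from x + 2.

open import Data.Bool using (true) renaming (_≟_ to _≟ᵇ_)
open import Data.Empty using (⊥; ⊥-elim)
open import Data.Fin using (Fin; toℕ)
open import Data.Fin.Properties using (toℕ-fromℕ<; toℕ-injective; toℕ<n; ¬∀⟶∃¬)
open import Data.Nat
open import Data.Nat.DivMod
open import Data.Nat.Divisibility using (∣-refl)
open import Data.Nat.Properties
open import Data.Product using (∃-syntax; _×_; _,_)
open import Data.Sum using (_⊎_; inj₁; inj₂; swap) renaming (map to ⊎-map)
open import Function.Base using (_∘_)
open import Function.Bundles using (_⇔_; mk⇔; Equivalence)
import Function.Properties.Equivalence as ⇔
open import Relation.Binary.PropositionalEquality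
open import Relation.Nullary using (¬_; Dec; yes; no; contradiction)
open import Relation.Unary using (Pred; Decidable)
open import Algebra.Properties.CommutativeSemigroup +-commutativeSemigroup using (x∙yz≈y∙xz)

open import Defs hiding (sym)

module _ {p} {P : Pred ℕ p} (P? : Decidable P) where

  last-in-range : ∀ {lo z} → lo ≤ z → P lo →
                  ∃[ s ] lo ≤ s × s ≤ z × P s × (∀ t → s < t → t ≤ z → ¬ P t)
  last-in-range lo≤z = last (≤⇒≤′ lo≤z)
    where
    extend : ∀ {s z} → ¬ P (suc z) → (∀ t → s < t → t ≤ z → ¬ P t) →
             ∀ t → s < t → t ≤ suc z → ¬ P t
    extend ¬Psz none t s<t t≤sz with m≤n⇒m<n∨m≡n t≤sz
    ... | inj₁ t<sz = none t s<t (s≤s⁻¹ t<sz)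
    ... | inj₂ refl = ¬Psz

    last : ∀ {lo z} → lo ≤′ z → P lo →
           ∃[ s ] lo ≤ s × s ≤ z × P s × (∀ t → s < t → t ≤ z → ¬ P t)
    last {z = z} lo≤z Plo with P? z
    ... | yes Pz = z , ≤′⇒≤ lo≤z , ≤-refl , Pz , λ _ z<t t≤z → contradiction t≤z (<⇒≱ z<t)
    last ≤′-refl Plo | no ¬Plo = contradiction Plo ¬Plo
    last (≤′-step lo≤z) Plo | no ¬Psz with last lo≤z Plo
    ... | s , lo≤s , s≤z , Ps , none = s , lo≤s , m≤n⇒m≤1+n s≤z , Ps , extend ¬Psz none

  first-in-range : ∀ {z hi} → z ≤ hi → P hi →
                   ∃[ e ] z ≤ e × e ≤ hi × P e × (∀ t → z ≤ t → t < e → ¬ P t)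
  first-in-range z≤hi = first (≤⇒≤‴ z≤hi)
    where
    extend : ∀ {z e} → ¬ P z → (∀ t → suc z ≤ t → t < e → ¬ P t) →
             ∀ t → z ≤ t → t < e → ¬ P t
    extend ¬Pz none t z≤t t<e with m≤n⇒m<n∨m≡n z≤t
    ... | inj₁ z<t = none t z<t t<e
    ... | inj₂ refl = ¬Pz

    first : ∀ {z hi} → z ≤‴ hi → P hi →
            ∃[ e ] z ≤ e × e ≤ hi × P e × (∀ t → z ≤ t → t < e → ¬ P t)
    first {z} z≤hi Phi with P? z
    ... | yes Pz = z , ≤-refl , ≤‴⇒≤ z≤hi , Pz , λ _ z≤t t<z → contradiction z≤t (<⇒≱ t<z)
    first ≤‴-refl Phi | no ¬Phi = contradiction Phi ¬Phi
    first (≤‴-step sz≤hi) Phi | no ¬Pz with first sz≤hi Phi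
    ... | e , sz≤e , e≤hi , Pe , none = e , <⇒≤ sz≤e , e≤hi , Pe , extend ¬Pz none

offset : ∀ {m n} → m ≤ n → ∃[ k ] k + m ≡ n
offset {m} {n} m≤n = n ∸ m , m∸n+n≡m m≤n

⊓-window : ∀ {m x y n} → x ≤ y → y ≤ n → m ≤ (y ∸ x) ⊓ (n ∸ (y ∸ x)) →
           m + x ≤ y × m + y ≤ n + x
⊓-window {m} {x} {y} {n} x≤y y≤n m≤⊓ = m≤o∸n⇒m+n≤o m x≤y (m≤n⊓o⇒m≤n _ _ m≤⊓) , (begin
  m + y             ≡⟨ cong (m +_) (m∸n+n≡m x≤y) ⟨
  m + (y ∸ x + x)   ≡⟨ +-assoc m (y ∸ x) x ⟨
  m + (y ∸ x) + x   ≤⟨ +-monoˡ-≤ x (m≤o∸n⇒m+n≤o m y∸x≤n (m≤n⊓o⇒m≤o _ _ m≤⊓)) ⟩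
  n + x             ∎)
  where
  open ≤-Reasoning
  y∸x≤n : y ∸ x ≤ n
  y∸x≤n = ≤-trans (m∸n≤m y x) y≤n

[m%o+n]%o≡[m+n]%o : ∀ m n o .{{_ : NonZero o}} → (m % o + n) % o ≡ (m + n) % o
[m%o+n]%o≡[m+n]%o m n o = begin
  (m % o + n) % o          ≡⟨ %-distribˡ-+ (m % o) n o ⟩
  (m % o % o + n % o) % o  ≡⟨ cong (λ r → (r + n % o) % o) (m%n%n≡m%n m o) ⟩
  (m % o + n % o) % o      ≡⟨ %-distribˡ-+ m n o ⟨
  (m + n) % o              ∎
  where open ≡-Reasoning

[m+n%o]%o≡[m+n]%o : ∀ m n o .{{_ : NonZero o}} → (m + n % o) % o ≡ (m + n) % o
[m+n%o]%o≡[m+n]%o m n o = begin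
  (m + n % o) % o          ≡⟨ %-distribˡ-+ m (n % o) o ⟩
  (m % o + n % o % o) % o  ≡⟨ cong (λ r → (m % o + r) % o) (m%n%n≡m%n n o) ⟩
  (m % o + n % o) % o      ≡⟨ %-distribˡ-+ m n o ⟨
  (m + n) % o              ∎
  where open ≡-Reasoning

%-≡⇒/-≤ : ∀ n .{{_ : NonZero n}} {a b} → a % n ≡ b % n → a < n + b → a / n ≤ b / n
%-≡⇒/-≤ n {a} {b} a≡b a<n+b =
  s≤s⁻¹ (*-cancelʳ-< n (a / n) (suc (b / n)) (+-cancelˡ-< (a % n) _ _ (begin-strict
    a % n + a / n * n        ≡⟨ m≡m%n+[m/n]*n a n ⟨
    a                        <⟨ a<n+b ⟩
    n + b                    ≡⟨ cong (n +_) (m≡m%n+[m/n]*n b n) ⟩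
    n + (b % n + b / n * n)  ≡⟨ x∙yz≈y∙xz n (b % n) _ ⟩
    b % n + suc (b / n) * n  ≡⟨ cong (_+ suc (b / n) * n) a≡b ⟨
    a % n + suc (b / n) * n  ∎)))
  where open ≤-Reasoning

%-injective-window : ∀ n .{{_ : NonZero n}} {a b} → a % n ≡ b % n → a < n + b → b < n + a → a ≡ b
%-injective-window n {a} {b} a≡b a<n+b b<n+a = begin
  a                  ≡⟨ m≡m%n+[m/n]*n a n ⟩
  a % n + a / n * n  ≡⟨ cong₂ (λ r q → r + q * n) a≡b same-quotient ⟩
  b % n + b / n * n  ≡⟨ m≡m%n+[m/n]*n b n ⟨
  b                  ∎
  where
  open ≡-Reasoning
  same-quotient : a / n ≡ b / n
  same-quotient = ≤-antisym (%-≡⇒/-≤ n a≡b a<n+b) (%-≡⇒/-≤ n (sym a≡b) b<n+a)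

Consecutive : ℕ → ℕ → Set
Consecutive t u = u ≡ suc t ⊎ t ≡ suc u

CycSuccℕ : ℕ → ℕ → ℕ → Set
CycSuccℕ m t u = (u ≡ suc t) ⊎ ((suc t ≡ m) × (u ≡ 0))

CycAdjℕ : ℕ → ℕ → ℕ → Set
CycAdjℕ m t u = CycSuccℕ m t u ⊎ CycSuccℕ m u t

CycAdjℕ-sym : ∀ {m t u} → CycAdjℕ m t u ⇔ CycAdjℕ m u t
CycAdjℕ-sym = mk⇔ swap swap

CycAdjℕ-irrefl₀ : ∀ {ℓ} → ¬ CycAdjℕ (2 + ℓ) 0 0
CycAdjℕ-irrefl₀ (inj₁ (inj₁ ()))
CycAdjℕ-irrefl₀ (inj₁ (inj₂ (() , _)))
CycAdjℕ-irrefl₀ (inj₂ (inj₁ ()))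
CycAdjℕ-irrefl₀ (inj₂ (inj₂ (() , _)))

CycAdjℕ-0-suc : ∀ {ℓ u} → CycAdjℕ (2 + ℓ) 0 (suc u) ⇔ (u ≡ 0 ⊎ u ≡ ℓ)
CycAdjℕ-0-suc = mk⇔ to from
  where
  to : ∀ {ℓ u} → CycAdjℕ (2 + ℓ) 0 (suc u) → u ≡ 0 ⊎ u ≡ ℓ
  to (inj₁ (inj₁ refl))          = inj₁ refl
  to (inj₁ (inj₂ (() , _)))
  to (inj₂ (inj₁ ()))
  to (inj₂ (inj₂ (refl , refl))) = inj₂ refl
  from : ∀ {ℓ u} → u ≡ 0 ⊎ u ≡ ℓ → CycAdjℕ (2 + ℓ) 0 (suc u)
  from (inj₁ refl) = inj₁ (inj₁ refl)
  from (inj₂ refl) = inj₂ (inj₂ (refl , refl))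

CycAdjℕ-suc-suc : ∀ {m t u} → CycAdjℕ m (suc t) (suc u) ⇔ Consecutive t u
CycAdjℕ-suc-suc = mk⇔ to from
  where
  to : ∀ {m t u} → CycAdjℕ m (suc t) (suc u) → Consecutive t u
  to (inj₁ (inj₁ refl))    = inj₁ refl
  to (inj₁ (inj₂ (_ , ())))
  to (inj₂ (inj₁ refl))    = inj₂ refl
  to (inj₂ (inj₂ (_ , ())))
  from : ∀ {m t u} → Consecutive t u → CycAdjℕ m (suc t) (suc u)
  from (inj₁ refl) = inj₁ (inj₁ refl)
  from (inj₂ refl) = inj₂ (inj₁ refl)

module Paths (G : Graph) where

  Adj-sym : ∀ {u v} → Adj G u v → Adj G v u
  Adj-sym {u} {v} u~v = trans (Graph.sym G v u) u~v

  Adj-sym⇔ : ∀ {u v} → Adj G u v ⇔ Adj G v u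
  Adj-sym⇔ = mk⇔ Adj-sym Adj-sym

  Adj? : ∀ u v → Dec (Adj G u v)
  Adj? u v = adj G u v ≟ᵇ true

  Adj⇒≢ : ∀ {u v} → Adj G u v → u ≢ v
  Adj⇒≢ {u} u~u refl = irrefl G u u~u

  record InducedPath (g : ℕ → Vertex G) (ℓ : ℕ) : Set where
    field
      injective : ∀ {t u} → t ≤ ℓ → u ≤ ℓ → g t ≡ g u → t ≡ u
      adjacent  : ∀ {t} → t < ℓ → Adj G (g t) (g (suc t))
      chordless : ∀ {t u} → t ≤ ℓ → u ≤ ℓ → Adj G (g t) (g u) → Consecutive t u

    adjacent⇔consecutive : ∀ {t u} → t ≤ ℓ → u ≤ ℓ → Adj G (g t) (g u) ⇔ Consecutive t u
    adjacent⇔consecutive {t} {u} t≤ℓ u≤ℓ = mk⇔ (chordless t≤ℓ u≤ℓ) consecutive⇒adjacent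
      where
      consecutive⇒adjacent : Consecutive t u → Adj G (g t) (g u)
      consecutive⇒adjacent (inj₁ refl) = adjacent u≤ℓ
      consecutive⇒adjacent (inj₂ refl) = Adj-sym (adjacent t≤ℓ)

  open InducedPath

  mkHole : (m : ℕ) → 4 ≤ m → (h : ℕ → Vertex G) →
         (∀ {t u} → t < m → u < m → h t ≡ h u → t ≡ u) →
         (∀ {t u} → t < m → u < m → Adj G (h t) (h u) ⇔ CycAdjℕ m t u) → Hole G
  mkHole m 4≤m h h-injective h-adjacency = record
    { len     = m
    ; len≥4   = 4≤m
    ; vtx     = λ i → h (toℕ i)
    ; inj     = λ hi≡hj → toℕ-injective (h-injective (toℕ<n _) (toℕ<n _) hi≡hj)
    ; induced = λ i j → h-adjacency (toℕ<n i) (toℕ<n j)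
    }

  infixr 5 _◂_
  _◂_ : Vertex G → (ℕ → Vertex G) → ℕ → Vertex G
  (w ◂ g) zero    = w
  (w ◂ g) (suc t) = g t

  ◂-injective : ∀ {g ℓ w} → (∀ {t u} → t ≤ ℓ → u ≤ ℓ → g t ≡ g u → t ≡ u) →
                (∀ {t} → t ≤ ℓ → w ≢ g t) →
                ∀ {t u} → t ≤ suc ℓ → u ≤ suc ℓ → (w ◂ g) t ≡ (w ◂ g) u → t ≡ u
  ◂-injective g-inj w∉g {zero}  {zero}  _  _  _     = refl
  ◂-injective g-inj w∉g {zero}  {suc u} _  u≤ w≡gu  = contradiction w≡gu (w∉g (s≤s⁻¹ u≤))
  ◂-injective g-inj w∉g {suc t} {zero}  t≤ _  gt≡w  = contradiction (sym gt≡w) (w∉g (s≤s⁻¹ t≤))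
  ◂-injective g-inj w∉g {suc t} {suc u} t≤ u≤ gt≡gu = cong suc (g-inj (s≤s⁻¹ t≤) (s≤s⁻¹ u≤) gt≡gu)

  ◂-inducedPath : ∀ {g ℓ w} → InducedPath g ℓ → Adj G w (g 0) →
                  (∀ {t} → 0 < t → t ≤ ℓ → ¬ Adj G w (g t)) → (∀ {t} → t ≤ ℓ → w ≢ g t) →
                  InducedPath (w ◂ g) (suc ℓ)
  ◂-inducedPath {g} {ℓ} {w} P w~g₀ w≁g w∉g = record
    { injective = ◂-injective (injective P) w∉g
    ; adjacent  = adjacent′
    ; chordless = chordless′
    }
    where
    adjacent′ : ∀ {t} → t < suc ℓ → Adj G ((w ◂ g) t) ((w ◂ g) (suc t))
    adjacent′ {zero}  _  = w~g₀
    adjacent′ {suc t} t< = adjacent P (s≤s⁻¹ t<)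

    only-first : ∀ {u} → u ≤ ℓ → Adj G w (g u) → u ≡ 0
    only-first {zero}  _   _    = refl
    only-first {suc u} u≤ℓ w~gu = contradiction w~gu (w≁g z<s u≤ℓ)

    chordless′ : ∀ {t u} → t ≤ suc ℓ → u ≤ suc ℓ →
                 Adj G ((w ◂ g) t) ((w ◂ g) u) → Consecutive t u
    chordless′ {zero}  {zero}  _  _  w~w   = contradiction w~w (irrefl G w)
    chordless′ {zero}  {suc u} _  u≤ w~gu  = inj₁ (cong suc (only-first (s≤s⁻¹ u≤) w~gu))
    chordless′ {suc t} {zero}  t≤ _  gt~w  = inj₂ (cong suc (only-first (s≤s⁻¹ t≤) (Adj-sym gt~w)))
    chordless′ {suc t} {suc u} t≤ u≤ gt~gu =
      ⊎-map (cong suc) (cong suc) (chordless P (s≤s⁻¹ t≤) (s≤s⁻¹ u≤) gt~gu)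

  ◂-hole : ∀ {g ℓ w} → InducedPath g ℓ → 2 ≤ ℓ → Adj G w (g 0) → Adj G w (g ℓ) →
           (∀ {t} → 0 < t → t < ℓ → ¬ Adj G w (g t)) → (∀ {t} → t ≤ ℓ → w ≢ g t) → Hole G
  ◂-hole {g} {ℓ} {w} P 2≤ℓ w~g₀ w~gℓ w≁g w∉g =
    mkHole (2 + ℓ) (s≤s (s≤s 2≤ℓ)) (w ◂ g)
      (λ t< u< → ◂-injective (injective P) w∉g (s≤s⁻¹ t<) (s≤s⁻¹ u<)) adjacency
    where
    only-ends : ∀ {u} → u ≤ ℓ → Adj G w (g u) → u ≡ 0 ⊎ u ≡ ℓ
    only-ends {zero}  _   _ = inj₁ refl
    only-ends {suc u} u≤ℓ w~gu with m≤n⇒m<n∨m≡n u≤ℓ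
    ... | inj₁ u<ℓ = contradiction w~gu (w≁g z<s u<ℓ)
    ... | inj₂ u≡ℓ = inj₂ u≡ℓ

    ends : ∀ {u} → u ≡ 0 ⊎ u ≡ ℓ → Adj G w (g u)
    ends (inj₁ refl) = w~g₀
    ends (inj₂ refl) = w~gℓ

    w-row : ∀ {u} → suc u < 2 + ℓ → Adj G w (g u) ⇔ CycAdjℕ (2 + ℓ) 0 (suc u)
    w-row u< = ⇔.trans (mk⇔ (only-ends (s≤s⁻¹ (s≤s⁻¹ u<))) ends) (⇔.sym CycAdjℕ-0-suc)

    adjacency : ∀ {t u} → t < 2 + ℓ → u < 2 + ℓ →
                Adj G ((w ◂ g) t) ((w ◂ g) u) ⇔ CycAdjℕ (2 + ℓ) t u
    adjacency {zero}  {zero}  _  _  = mk⇔ (⊥-elim ∘ irrefl G w) (⊥-elim ∘ CycAdjℕ-irrefl₀)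
    adjacency {zero}  {suc u} _  u< = w-row u<
    adjacency {suc t} {zero}  t< _  = ⇔.trans Adj-sym⇔ (⇔.trans (w-row t<) CycAdjℕ-sym)
    adjacency {suc t} {suc u} t< u< =
      ⇔.trans (adjacent⇔consecutive P (s≤s⁻¹ (s≤s⁻¹ t<)) (s≤s⁻¹ (s≤s⁻¹ u<)))
              (⇔.sym CycAdjℕ-suc-suc)

module _ {G : Graph} (C : Hole G) where

  open Paths G

  L : ℕ
  L = len C

  instance
    L-nonZero : NonZero L
    L-nonZero = >-nonZero (≤-trans (s≤s z≤n) (len≥4 C))

  c : ℕ → Vertex G
  c t = vtx C (t mod L)

  toℕ-mod : ∀ t → toℕ (t mod L) ≡ t % L
  toℕ-mod t = toℕ-fromℕ< (m%n<n t L)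

  mod-cong : ∀ {t u} → t % L ≡ u % L → t mod L ≡ u mod L
  mod-cong {t} {u} t≡u = toℕ-injective (trans (toℕ-mod t) (trans t≡u (sym (toℕ-mod u))))

  c-toℕ : ∀ i → c (toℕ i) ≡ vtx C i
  c-toℕ i = cong (vtx C) (toℕ-injective (trans (toℕ-mod (toℕ i)) (m<n⇒m%n≡m (toℕ<n i))))

  c-+L : ∀ t → c (L + t) ≡ c t
  c-+L t = cong (vtx C) (mod-cong (%-remove-+ˡ t ∣-refl))

  c-injective : ∀ {t u} → c t ≡ c u → t < L + u → u < L + t → t ≡ u
  c-injective {t} {u} ct≡cu = %-injective-window L (begin
    t % L            ≡⟨ toℕ-mod t ⟨
    toℕ (t mod L)    ≡⟨ cong toℕ (inj C ct≡cu) ⟩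
    toℕ (u mod L)    ≡⟨ toℕ-mod u ⟩
    u % L            ∎)
    where open ≡-Reasoning

  cycSucc-mod : ∀ t → CycSucc L (t mod L) (suc t mod L)
  cycSucc-mod t with m≤n⇒m<n∨m≡n (m%n<n t L)
  ... | inj₁ 1+r<L = inj₁ (begin
    toℕ (suc t mod L)    ≡⟨ toℕ-mod (suc t) ⟩
    suc t % L            ≡⟨ [m+n%o]%o≡[m+n]%o 1 t L ⟨
    suc (t % L) % L      ≡⟨ m<n⇒m%n≡m 1+r<L ⟩
    suc (t % L)          ≡⟨ cong suc (toℕ-mod t) ⟨
    suc (toℕ (t mod L))  ∎)
    where open ≡-Reasoning
  ... | inj₂ 1+r≡L = inj₂ (trans (cong suc (toℕ-mod t)) 1+r≡L , (begin
    toℕ (suc t mod L)    ≡⟨ toℕ-mod (suc t) ⟩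
    suc t % L            ≡⟨ [m+n%o]%o≡[m+n]%o 1 t L ⟨
    suc (t % L) % L      ≡⟨ cong (_% L) 1+r≡L ⟩
    L % L                ≡⟨ n%n≡0 L ⟩
    0                    ∎))
    where open ≡-Reasoning

  cycSucc⇒suc-≡ : ∀ {t u} → CycSucc L (t mod L) (u mod L) → suc t % L ≡ u % L
  cycSucc⇒suc-≡ {t} {u} (inj₁ u≡1+t) = begin
    suc t % L                ≡⟨ [m+n%o]%o≡[m+n]%o 1 t L ⟨
    suc (t % L) % L          ≡⟨ cong (λ r → suc r % L) (toℕ-mod t) ⟨
    suc (toℕ (t mod L)) % L  ≡⟨ cong (_% L) u≡1+t ⟨
    toℕ (u mod L) % L        ≡⟨ cong (_% L) (toℕ-mod u) ⟩
    u % L % L                ≡⟨ m%n%n≡m%n u L ⟩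
    u % L                    ∎
    where open ≡-Reasoning
  cycSucc⇒suc-≡ {t} {u} (inj₂ (1+t≡L , u≡0)) = begin
    suc t % L                ≡⟨ [m+n%o]%o≡[m+n]%o 1 t L ⟨
    suc (t % L) % L          ≡⟨ cong (λ r → suc r % L) (toℕ-mod t) ⟨
    suc (toℕ (t mod L)) % L  ≡⟨ cong (_% L) 1+t≡L ⟩
    L % L                    ≡⟨ n%n≡0 L ⟩
    0                        ≡⟨ u≡0 ⟨
    toℕ (u mod L)            ≡⟨ toℕ-mod u ⟩
    u % L                    ∎
    where open ≡-Reasoning

  c-step : ∀ t → Adj G (c t) (c (suc t))
  c-step t = Equivalence.from (induced C _ _) (inj₁ (cycSucc-mod t))

  cycSucc⇒≡ : ∀ {t u} → CycSucc L (t mod L) (u mod L) → suc t < L + u → suc u < L + t → u ≡ suc t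
  cycSucc⇒≡ {t} t→u 1+t<L+u 1+u<L+t = sym (%-injective-window L (cycSucc⇒suc-≡ t→u) 1+t<L+u
    (≤-trans (<⇒≤ 1+u<L+t) (+-monoʳ-≤ L (n≤1+n t))))

  c-adjacent⇒consecutive : ∀ {t u} → Adj G (c t) (c u) → suc t < L + u → suc u < L + t →
                           Consecutive t u
  c-adjacent⇒consecutive ct~cu 1+t<L+u 1+u<L+t =
    ⊎-map (λ t→u → cycSucc⇒≡ t→u 1+t<L+u 1+u<L+t) (λ u→t → cycSucc⇒≡ u→t 1+u<L+t 1+t<L+u)
          (Equivalence.to (induced C _ _) ct~cu)

  arc : ∀ s ℓ → 2 + ℓ ≤ L → InducedPath (λ t → c (t + s)) ℓ
  arc s ℓ 2+ℓ≤L = record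
    { injective = λ {t} {u} t≤ℓ u≤ℓ ct≡cu →
        +-cancelʳ-≡ s t u (c-injective ct≡cu (<-trans (n<1+n _) (window u t≤ℓ))
                                             (<-trans (n<1+n _) (window t u≤ℓ)))
    ; adjacent  = λ {t} _ → c-step (t + s)
    ; chordless = λ {t} {u} t≤ℓ u≤ℓ ct~cu →
        ⊎-map (+-cancelʳ-≡ s u (suc t)) (+-cancelʳ-≡ s t (suc u))
              (c-adjacent⇒consecutive ct~cu (window u t≤ℓ) (window t u≤ℓ))
    }
    where
    window : ∀ {t} u → t ≤ ℓ → suc t + s < L + (u + s)
    window {t} u t≤ℓ = begin-strict
      suc t + s    <⟨ +-monoˡ-< s (≤-trans (s≤s (s≤s t≤ℓ)) 2+ℓ≤L) ⟩
      L + s        ≤⟨ +-monoʳ-≤ L (m≤n+m s u) ⟩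
      L + (u + s)  ∎
      where open ≤-Reasoning

  mod-surjective : ∀ x (i : Fin L) → ∃[ z ] z < L × (z + x) mod L ≡ i
  mod-surjective x i = z , m%n<n _ L , toℕ-injective (begin
    toℕ ((z + x) mod L)           ≡⟨ toℕ-mod (z + x) ⟩
    (z + x) % L                   ≡⟨ [m%o+n]%o≡[m+n]%o (toℕ i + x * pred L) x L ⟩
    (toℕ i + x * pred L + x) % L  ≡⟨ cong (_% L) shift ⟩
    (toℕ i + x * L) % L           ≡⟨ [m+kn]%n≡m%n (toℕ i) x L ⟩
    toℕ i % L                     ≡⟨ m<n⇒m%n≡m (toℕ<n i) ⟩
    toℕ i                         ∎)
    where
    open ≡-Reasoning
    z : ℕ
    z = (toℕ i + x * pred L) % L  -- ≡ i − x (mod L), without truncated subtraction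
    shift : toℕ i + x * pred L + x ≡ toℕ i + x * L
    shift = begin
      toℕ i + x * pred L + x    ≡⟨ +-assoc (toℕ i) _ x ⟩
      toℕ i + (x * pred L + x)  ≡⟨ cong (toℕ i +_) (+-comm _ x) ⟩
      toℕ i + (x + x * pred L)  ≡⟨ cong (toℕ i +_) (*-suc x (pred L)) ⟨
      toℕ i + x * suc (pred L)  ≡⟨ cong (λ k → toℕ i + x * k) (suc-pred L) ⟩
      toℕ i + x * L             ∎

  distC-comm : ∀ i j → distC C i j ≡ distC C j i
  distC-comm i j = cong (λ d → d ⊓ (L ∸ d)) (∣-∣-comm (toℕ i) (toℕ j))

  distC-window : ∀ {m i j} → toℕ i ≤ toℕ j → m ≤ distC C i j →
                 m + toℕ i ≤ toℕ j × m + toℕ j ≤ L + toℕ i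
  distC-window {m} i≤j m≤dist = ⊓-window i≤j (<⇒≤ (toℕ<n _))
    (subst (λ d → m ≤ d ⊓ (L ∸ d)) (m≤n⇒∣m-n∣≡n∸m i≤j) m≤dist)

  InZ-toℕ : ∀ {i a} → InZ C (vtx C i) a → InZ C (c (toℕ i)) a
  InZ-toℕ {i} = subst (λ v → InZ C v _) (sym (c-toℕ i))

  Sees : Vertex G → ℕ → Set
  Sees w t = Adj G w (c t)

  Sees? : ∀ w → Decidable (Sees w)
  Sees? w t = Adj? w (c t)

  ∉C⇒≢c : ∀ {w} → ¬ InHole C w → ∀ t → w ≢ c t
  ∉C⇒≢c w∉C t w≡ct = w∉C (t mod L , sym w≡ct)

  module _ (shortest : ShortestHole C) where

    ¬short-detour₁ : ∀ {w s e} → ¬ InHole C w → 2 + s ≤ e → 3 + e ≤ L + s →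
                     Sees w s → Sees w e → (∀ t → s < t → t < e → ¬ Sees w t) → ⊥
    ¬short-detour₁ {w} {s} w∉C 2+s≤e 3+e≤L+s w~s w~e w≁inner
      with offset (≤-trans (m≤n+m s 2) 2+s≤e)
    ... | ℓ , refl = <⇒≱ 3+ℓ≤L (shortest (◂-hole (arc s ℓ (≤-trans (n≤1+n _) 3+ℓ≤L)) 2≤ℓ w~s w~e
                                              w≁arc (λ {t} _ → ∉C⇒≢c w∉C (t + s))))
      where
      2≤ℓ : 2 ≤ ℓ
      2≤ℓ = +-cancelʳ-≤ s 2 ℓ 2+s≤e
      3+ℓ≤L : 3 + ℓ ≤ L
      3+ℓ≤L = +-cancelʳ-≤ s (3 + ℓ) L 3+e≤L+s
      w≁arc : ∀ {t} → 0 < t → t < ℓ → ¬ Sees w (t + s)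
      w≁arc {t} 0<t t<ℓ = w≁inner (t + s) (m<n+m s 0<t) (+-monoˡ-< s t<ℓ)

    ¬short-detour₂ : ∀ {u v s e} → ¬ InHole C u → ¬ InHole C v → Adj G u v → s < e → 4 + e ≤ L + s →
                     Sees u s → Sees v e → (∀ t → s < t → t ≤ e → ¬ Sees u t) →
                     (∀ t → s ≤ t → t < e → ¬ Sees v t) → ⊥
    ¬short-detour₂ {u} {v} {s} u∉C v∉C u~v s<e 4+e≤L+s u~s v~e u≁after v≁before
      with offset (<⇒≤ s<e)
    ... | ℓ , refl = <⇒≱ 4+ℓ≤L (shortest (◂-hole path (s≤s 1≤ℓ) (Adj-sym u~v) v~e v≁path v∉path))
      where
      1≤ℓ : 1 ≤ ℓ
      1≤ℓ = +-cancelʳ-≤ s 1 ℓ s<e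
      4+ℓ≤L : 4 + ℓ ≤ L
      4+ℓ≤L = +-cancelʳ-≤ s (4 + ℓ) L 4+e≤L+s
      g : ℕ → Vertex G
      g t = c (t + s)
      path : InducedPath (u ◂ g) (suc ℓ)
      path = ◂-inducedPath (arc s ℓ (≤-trans (≤-trans (n≤1+n _) (n≤1+n _)) 4+ℓ≤L)) u~s
               (λ {t} 0<t t≤ℓ → u≁after (t + s) (m<n+m s 0<t) (+-monoˡ-≤ s t≤ℓ))
               (λ {t} _ → ∉C⇒≢c u∉C (t + s))
      v≁path : ∀ {t} → 0 < t → t < suc ℓ → ¬ Adj G v ((u ◂ g) t)
      v≁path {suc t} _ t<ℓ = v≁before (t + s) (m≤n+m s t) (+-monoˡ-< s (s≤s⁻¹ t<ℓ))
      v∉path : ∀ {t} → t ≤ suc ℓ → v ≢ (u ◂ g) t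
      v∉path {zero}  _ = Adj⇒≢ (Adj-sym u~v)
      v∉path {suc t} _ = ∉C⇒≢c v∉C (t + s)

    sees-between : ∀ {w lo z hi} → ¬ InHole C w → Sees w lo → Sees w hi →
                   lo ≤ z → z ≤ hi → 3 + hi ≤ L + lo → Sees w z
    sees-between {w} {lo} {z} {hi} w∉C w~lo w~hi lo≤z z≤hi 3+hi≤L+lo with Sees? w z
    ... | yes w~z = w~z
    ... | no w≁z with last-in-range (Sees? w) lo≤z w~lo | first-in-range (Sees? w) z≤hi w~hi
    ... | s , lo≤s , s≤z , w~s , w≁after-s | e , z≤e , e≤hi , w~e , w≁before-e =
      ⊥-elim (¬short-detour₁ w∉C (≤-trans (s≤s s<z) z<e) 3+e≤L+s w~s w~e w≁between)
      where
      s<z : s < z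
      s<z = ≤∧≢⇒< s≤z (λ s≡z → w≁z (subst (Sees w) s≡z w~s))
      z<e : z < e
      z<e = ≤∧≢⇒< z≤e (λ z≡e → w≁z (subst (Sees w) (sym z≡e) w~e))
      3+e≤L+s : 3 + e ≤ L + s
      3+e≤L+s = begin
        3 + e   ≤⟨ +-monoʳ-≤ 3 e≤hi ⟩
        3 + hi  ≤⟨ 3+hi≤L+lo ⟩
        L + lo  ≤⟨ +-monoʳ-≤ L lo≤s ⟩
        L + s   ∎
        where open ≤-Reasoning
      w≁between : ∀ t → s < t → t < e → ¬ Sees w t
      w≁between t s<t t<e with t ≤? z
      ... | yes t≤z = w≁after-s t s<t t≤z
      ... | no t≰z  = w≁before-e t (<⇒≤ (≰⇒> t≰z)) t<e

    ¬far-neighbours : ∀ {w p q} → ¬ InHole C w → ¬ InD C w → Sees w p → Sees w q →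
                      3 + p ≤ q → 3 + q ≤ L + p → ⊥
    ¬far-neighbours {w} {p} {q} w∉C w∉D w~p w~q 3+p≤q 3+q≤L+p
      with ¬∀⟶∃¬ L (λ i → Adj G (vtx C i) w) (λ i → Adj? (vtx C i) w) w∉D
    ... | i , i≁w with mod-surjective p i
    ... | z , z<L , refl = i≁w (Adj-sym w~z)
      where
      w~z : Sees w (z + p)
      w~z with z + p ≤? q
      ... | yes z+p≤q = sees-between w∉C w~p w~q (m≤n+m p z) z+p≤q 3+q≤L+p
      ... | no z+p≰q  = sees-between w∉C w~q (subst (Adj G w) (sym (c-+L p)) w~p)
                          (<⇒≤ (≰⇒> z+p≰q)) (+-monoˡ-≤ p (<⇒≤ z<L))
                          (subst (_≤ L + q) (x∙yz≈y∙xz L 3 p) (+-monoʳ-≤ L 3+p≤q))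

    edge⇒common-neighbour : ∀ {a b x y} → ¬ InHole C a → ¬ InD C a → ¬ InHole C b → ¬ InD C b →
                            Adj G a b → Sees a x → Sees b y → 4 + x ≤ y → 4 + y ≤ L + x →
                            y ≡ 4 + x × Sees a (2 + x) × Sees b (2 + x)
    edge⇒common-neighbour {a} {b} {x} {y} a∉C a∉D b∉C b∉D a~b a~x b~y 4+x≤y 4+y≤L+x
      with last-in-range (Sees? a) (≤-trans (m≤n+m x 4) 4+x≤y) a~x
    ... | s , x≤s , s≤y , a~s , a≁after-s with first-in-range (Sees? b) s≤y b~y
    ... | e , s≤e , e≤y , b~e , b≁before-e with m≤n⇒m<n∨m≡n s≤e
    ...   | inj₁ s<e = ⊥-elim (¬short-detour₂ a∉C b∉C a~b s<e (far-end e≤y)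
                                a~s b~e (λ t s<t t≤e → a≁after-s t s<t (≤-trans t≤e e≤y))
                                b≁before-e)
      where
      far-end : ∀ {t} → t ≤ y → 4 + t ≤ L + s
      far-end t≤y = ≤-trans (+-monoʳ-≤ 4 t≤y) (≤-trans 4+y≤L+x (+-monoʳ-≤ L x≤s))
    ...   | inj₂ refl = y≡4+x , subst (Sees a) s≡2+x a~s , subst (Sees b) s≡2+x b~e
      where
      3+y≤L+s : 3 + y ≤ L + s
      3+y≤L+s = ≤-trans (n≤1+n _) (≤-trans 4+y≤L+x (+-monoʳ-≤ L x≤s))
      s≤2+x : s ≤ 2 + x
      s≤2+x = ≮⇒≥ (λ 3+x≤s → ¬far-neighbours a∉C a∉D a~x a~s 3+x≤s
                                 (≤-trans (+-monoʳ-≤ 3 s≤y) (≤-trans (n≤1+n _) 4+y≤L+x)))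
      y≤2+s : y ≤ 2 + s
      y≤2+s = ≮⇒≥ (λ 3+s≤y → ¬far-neighbours b∉C b∉D b~e b~y 3+s≤y 3+y≤L+s)
      s≡2+x : s ≡ 2 + x
      s≡2+x = ≤-antisym s≤2+x (+-cancelˡ-≤ 2 (2 + x) s (≤-trans 4+x≤y y≤2+s))
      y≡4+x : y ≡ 4 + x
      y≡4+x = ≤-antisym (subst (λ r → y ≤ 2 + r) s≡2+x y≤2+s) 4+x≤y

    -- Rerunning the argument on the complementary arc, from y to L + x, gives a the neighbour 6 + x,
    -- too far from 2 + x.
    ¬edge-between-attachments : ∀ {a b x y} → ¬ InHole C a → ¬ InD C a → ¬ InHole C b → ¬ InD C b →
                                Adj G a b → Sees a x → Sees b y → 4 + x ≤ y → 4 + y ≤ L + x → ⊥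
    ¬edge-between-attachments {a} {x = x} a∉C a∉D b∉C b∉D a~b a~x b~y 4+x≤y 4+y≤L+x
      with edge⇒common-neighbour a∉C a∉D b∉C b∉D a~b a~x b~y 4+x≤y 4+y≤L+x
    ... | refl , a~2+x , _
      with edge⇒common-neighbour b∉C b∉D a∉C a∉D (Adj-sym a~b) b~y
             (subst (Adj G a) (sym (c-+L x)) a~x) 4+y≤L+x (≤-reflexive (x∙yz≈y∙xz 4 L x))
    ... | _ , _ , a~6+x = ¬far-neighbours a∉C a∉D a~2+x a~6+x (n≤1+n _)
            (subst (9 + x ≤_) (x∙yz≈y∙xz 2 L x) (s≤s (s≤s (≤-trans (n≤1+n _) 4+y≤L+x))))

    no-edge-between-Z : ∀ {x y a b} → 4 + x ≤ y → 4 + y ≤ L + x →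
                        InZ C (c x) a → InZ C (c y) b → ¬ Adj G a b
    no-edge-between-Z {x} {y} 4+x≤y 4+y≤L+x = no-edge
      where
      3+x≤y : 3 + x ≤ y
      3+x≤y = ≤-trans (n≤1+n _) 4+x≤y
      3+y≤L+x : 3 + y ≤ L + x
      3+y≤L+x = ≤-trans (n≤1+n _) 4+y≤L+x

      no-edge : ∀ {a b} → InZ C (c x) a → InZ C (c y) b → ¬ Adj G a b
      no-edge (inj₁ refl) (inj₁ refl) cx~cy
        with c-adjacent⇒consecutive cx~cy (≤-trans (m≤n+m _ 2) (≤-trans 4+x≤y (m≤n+m y L)))
                                          (≤-trans (m≤n+m _ 2) 4+y≤L+x)
      ... | inj₁ y≡1+x = <⇒≱ (m<n+m (suc x) {3} z<s) (subst (4 + x ≤_) y≡1+x 4+x≤y)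
      ... | inj₂ x≡1+y = <⇒≱ (m<n+m y {5} z<s) (subst (λ r → 4 + r ≤ y) x≡1+y 4+x≤y)
      no-edge (inj₁ refl) (inj₂ (cy~b , b∉C , b∉D)) cx~b =
        ¬far-neighbours b∉C b∉D (Adj-sym cx~b) (Adj-sym cy~b) 3+x≤y 3+y≤L+x
      no-edge (inj₂ (cx~a , a∉C , a∉D)) (inj₁ refl) a~cy =
        ¬far-neighbours a∉C a∉D (Adj-sym cx~a) a~cy 3+x≤y 3+y≤L+x
      no-edge (inj₂ (cx~a , a∉C , a∉D)) (inj₂ (cy~b , b∉C , b∉D)) a~b =
        ¬edge-between-attachments a∉C a∉D b∉C b∉D a~b (Adj-sym cx~a) (Adj-sym cy~b) 4+x≤y 4+y≤L+x

    no-edge-between-Z-Fin : ∀ {i j a b} → toℕ i ≤ toℕ j → 4 ≤ distC C i j →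
                            InZ C (vtx C i) a → InZ C (vtx C j) b → ¬ Adj G a b
    no-edge-between-Z-Fin i≤j 4≤dist a∈Z b∈Z =
      let 4+x≤y , 4+y≤L+x = distC-window i≤j 4≤dist
      in  no-edge-between-Z 4+x≤y 4+y≤L+x (InZ-toℕ a∈Z) (InZ-toℕ b∈Z)

lemma4p2 : (G : Graph) (k : ℕ) → 1 ≤ k → (C : Hole G) → ShortestHole C → MuLt k (len C) → ChordalMinus C
           → ∀ i j → 4 ≤ distC C i j → ∀ a b → InZ C (vtx C i) a → InZ C (vtx C j) b → ¬ Adj G a b
lemma4p2 G _ _ C shortest _ _ i j 4≤dist a b a∈Z b∈Z with ≤-total (toℕ i) (toℕ j)
... | inj₁ i≤j = no-edge-between-Z-Fin C shortest i≤j 4≤dist a∈Z b∈Z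
... | inj₂ j≤i = λ a~b → no-edge-between-Z-Fin C shortest j≤i (subst (4 ≤_) (distC-comm C i j) 4≤dist)
                                                b∈Z a∈Z (Paths.Adj-sym G a~b)
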